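{- In $\mathbb{Z}_{123}$ let $H=\{1,10,16,37,100\}$, and write $HS=\{hs\bmod 123: h\in H, s\in S\}$. Let $X=H\{0,1,3,6,11,13,28,29,33,35,43,45,59\}$ and $Y=H\{4,5,6,11,14,15,18,19,22,28,33,41,45\}$. Then $(X,Y)$ is a difference family in $\mathbb{Z}_{123}$ with parameters $(123;61,61;60)$; consequently a cyclic Legendre pair of length $123$ exists.
   Context: A pair $(X,Y)$ of subsets of $\mathbb{Z}_v$ with $|X|=k_1$, $|Y|=k_2$ is a difference family with parameters $(v;k_1,k_2;\lambda)$ if every nonzero $d\in\mathbb{Z}_v$ arises as $x-x'$ ($x,x'\in X$) or $y-y'$ ($y,y'\in Y$) in exactly $\lambda$ ways in total. A cyclic Legendre pair of length $v$ is a pair of functions $f,g:\mathbb{Z}_v\to\{+1,-1\}$ with $\sum_{x}f(x)f(x+s)+\sum_x g(x)g(x+s)=-2$ for all nonzero $s\in\mathbb{Z}_v$; it corresponds to the difference family $(\{f=-1\},\{g=-1\})$ with $\lambda=k_1+k_2-(v+1)/2$. -}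

module Defs where

open import Data.Nat using (ℕ; zero; suc; _+_; _*_; _∸_; NonZero)
open import Data.Nat.DivMod using (_mod_)
open import Data.Fin using (Fin; toℕ; _≟_)
open import Data.Fin.Subset using (Subset; ∣_∣)
open import Data.Bool using (Bool; true; false; _∧_; _∨_; if_then_else_)
open import Data.List using (List; []; _∷_; map; foldr; allFin)
open import Data.Bool.ListAction using (any)
open import Data.Vec using (tabulate; lookup)
open import Data.Integer as ℤ using (ℤ)
open import Data.Product using (_×_; Σ)
open import Data.Sum using (_⊎_)
open import Relation.Nullary.Decidable using (⌊_⌋)
open import Relation.Binary.PropositionalEquality using (_≡_; _≢_)

_⊕_ : {v : ℕ} .{{_ : NonZero v}} → Fin v → Fin v → Fin v
_⊕_ {v} x y = (toℕ x + toℕ y) mod v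

_⊖_ : {v : ℕ} .{{_ : NonZero v}} → Fin v → Fin v → Fin v
_⊖_ {v} x y = (toℕ x + (v ∸ toℕ y)) mod v

sumℕ : List ℕ → ℕ
sumℕ = foldr _+_ 0

sumℤ : List ℤ → ℤ
sumℤ = foldr ℤ._+_ (ℤ.+ 0)

mulSet : (v : ℕ) .{{_ : NonZero v}} → List ℕ → List ℕ → Subset v
mulSet v H S = tabulate λ x →
  any (λ h → any (λ s → ⌊ ((h * s) mod v) ≟ x ⌋) S) H

diffCount : {v : ℕ} .{{_ : NonZero v}} → Subset v → Fin v → ℕ
diffCount {v} X d =
  sumℕ (map (λ x → sumℕ (map (λ x' →
    if lookup X x ∧ lookup X x' ∧ ⌊ (x ⊖ x') ≟ d ⌋ then 1 else 0)
      (allFin v))) (allFin v))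

IsDifferenceFamily : (v : ℕ) .{{_ : NonZero v}} → (k₁ k₂ lam : ℕ) →
                     Subset v → Subset v → Set
IsDifferenceFamily v k₁ k₂ lam X Y =
  ∣ X ∣ ≡ k₁ × ∣ Y ∣ ≡ k₂ ×
  ((d : Fin v) → toℕ d ≢ 0 → diffCount X d + diffCount Y d ≡ lam)

autocorr : {v : ℕ} .{{_ : NonZero v}} → (Fin v → ℤ) → Fin v → ℤ
autocorr {v} f s = sumℤ (map (λ x → f x ℤ.* f (x ⊕ s)) (allFin v))

IsPM1 : {v : ℕ} → (Fin v → ℤ) → Set
IsPM1 f = ∀ x → f x ≡ ℤ.+ 1 ⊎ f x ≡ ℤ.- (ℤ.+ 1)

IsLegendrePair : (v : ℕ) .{{_ : NonZero v}} → (Fin v → ℤ) → (Fin v → ℤ) → Set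
IsLegendrePair v f g =
  IsPM1 f × IsPM1 g ×
  ((s : Fin v) → toℕ s ≢ 0 → autocorr f s ℤ.+ autocorr g s ≡ ℤ.- (ℤ.+ 2))

LegendrePairExists : (v : ℕ) .{{_ : NonZero v}} → Set
LegendrePairExists v = Σ (Fin v → ℤ) λ f → Σ (Fin v → ℤ) λ g → IsLegendrePair v f g

H₁₂₃ : List ℕ
H₁₂₃ = 1 ∷ 10 ∷ 16 ∷ 37 ∷ 100 ∷ []

X₁₂₃ : Subset 123
X₁₂₃ = mulSet 123 H₁₂₃ (0 ∷ 1 ∷ 3 ∷ 6 ∷ 11 ∷ 13 ∷ 28 ∷ 29 ∷ 33 ∷ 35 ∷ 43 ∷ 45 ∷ 59 ∷ [])

Y₁₂₃ : Subset 123
Y₁₂₃ = mulSet 123 H₁₂₃ (4 ∷ 5 ∷ 6 ∷ 11 ∷ 14 ∷ 15 ∷ 18 ∷ 19 ∷ 22 ∷ 28 ∷ 33 ∷ 41 ∷ 45 ∷ [])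

module Submission where

-- Write a subset X of ℤ_v as the ±1 sequence f = 1 − 2·1_X. Expanding f(x) f(x + s) and using that
-- x ↦ x + s permutes ℤ_v gives  Σ_x f(x) f(x + s) = v − 4|X| + 4·#{x ∈ X : x + s ∈ X},  and the last
-- count is the number of ways s arises as a difference of two elements of X. Adding this for X and Y,
-- the difference-family condition turns the right-hand side into 2v − 4(k₁ + k₂) + 4λ, which is −2
-- exactly when 2λ = 2(k₁ + k₂) − v − 1. That the given sets form a (123; 61, 61; 60) difference
-- family is checked by evaluation, through the same count of coincidences.

open import Defs
open import Data.Bool using (true; false; if_then_else_; _∧_)
open import Data.Empty using (⊥-elim)
open import Data.Fin using (Fin; toℕ; zero; suc; _≟_)
open import Data.Fin.Permutation using (Permutation′; permutation)
open import Data.Fin.Properties using (toℕ-fromℕ<; toℕ-injective; toℕ<n; toℕ≤n; all?)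
open import Data.Fin.Subset using (Subset; ∣_∣)
open import Data.Integer using (ℤ; +_; -_) renaming (_+_ to _+ℤ_; _-_ to _-ℤ_; _*_ to _*ℤ_)
open import Data.Integer.Properties using (pos-+)
open import Data.List as List using (List; map; allFin)
open import Data.List.Properties using (map-cong; map-∘; map-tabulate)
open import Data.Nat as ℕ using (ℕ; _+_; _*_; _∸_; _%_; NonZero)
open import Data.Nat.DivMod using (_mod_; %-distribˡ-+; m%n%n≡m%n; [m+n]%n≡m%n; m<n⇒m%n≡m)
open import Data.Nat.Properties using (+-comm; +-assoc; +-identityʳ; *-identityʳ; *-zeroʳ; m∸n+n≡m; m+[n∸m]≡n; +-0-commutativeMonoid; +-*-semiring)
open import Data.Product using (_×_; _,_)
open import Data.Sum using (inj₁; inj₂)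
open import Data.Unit using (tt)
open import Data.Vec using (_∷_; []; lookup)
open import Function using (_∘_)
open import Relation.Binary.PropositionalEquality
open import Relation.Nullary using (yes; no)
open import Relation.Nullary.Decidable using (⌊_⌋; toWitness)
import Data.Integer.Tactic.RingSolver as ℤ-Solver
import Data.Nat.Tactic.RingSolver as ℕ-Solver

open import Algebra.Properties.CommutativeMonoid.Sum +-0-commutativeMonoid using (∑-comm; ∑-distrib-+; ∑-permute; sum-cong-≗; sum-replicate-zero; sum-syntax)
open import Algebra.Properties.Semiring.Sum +-*-semiring using (*-distribˡ-sum)
open ≡-Reasoning

module _ {v : ℕ} .{{_ : NonZero v}} where

  toℕ-⊕ : (x y : Fin v) → toℕ (x ⊕ y) ≡ (toℕ x + toℕ y) % v
  toℕ-⊕ x y = toℕ-fromℕ< _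

  toℕ-⊖ : (x y : Fin v) → toℕ (x ⊖ y) ≡ (toℕ x + (v ∸ toℕ y)) % v
  toℕ-⊖ x y = toℕ-fromℕ< _

  [m%v+n]%v≡[m+n]%v : ∀ m n → (m % v + n) % v ≡ (m + n) % v
  [m%v+n]%v≡[m+n]%v m n = begin
    (m % v + n) % v           ≡⟨ %-distribˡ-+ (m % v) n v ⟩
    (m % v % v + n % v) % v   ≡⟨ cong (λ a → (a + n % v) % v) (m%n%n≡m%n m v) ⟩
    (m % v + n % v) % v       ≡⟨ %-distribˡ-+ m n v ⟨
    (m + n) % v               ∎

  [x+v]%v≡x : (x : Fin v) → (toℕ x + v) % v ≡ toℕ x
  [x+v]%v≡x x = trans ([m+n]%n≡m%n (toℕ x) v) (m<n⇒m%n≡m (toℕ<n x))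

  ⊕-comm : (x y : Fin v) → x ⊕ y ≡ y ⊕ x
  ⊕-comm x y = cong (_mod v) (+-comm (toℕ x) (toℕ y))

  ⊖-⊕-cancel : (x y : Fin v) → (x ⊖ y) ⊕ y ≡ x
  ⊖-⊕-cancel x y = toℕ-injective (begin
    toℕ ((x ⊖ y) ⊕ y)                        ≡⟨ toℕ-⊕ (x ⊖ y) y ⟩
    (toℕ (x ⊖ y) + toℕ y) % v                ≡⟨ cong (λ a → (a + toℕ y) % v) (toℕ-⊖ x y) ⟩
    ((toℕ x + (v ∸ toℕ y)) % v + toℕ y) % v  ≡⟨ [m%v+n]%v≡[m+n]%v (toℕ x + (v ∸ toℕ y)) (toℕ y) ⟩
    (toℕ x + (v ∸ toℕ y) + toℕ y) % v        ≡⟨ cong (_% v) (+-assoc (toℕ x) (v ∸ toℕ y) (toℕ y)) ⟩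
    (toℕ x + ((v ∸ toℕ y) + toℕ y)) % v      ≡⟨ cong (λ a → (toℕ x + a) % v) (m∸n+n≡m (toℕ≤n y)) ⟩
    (toℕ x + v) % v                          ≡⟨ [x+v]%v≡x x ⟩
    toℕ x                                    ∎)

  ⊕-⊖-cancel : (x y : Fin v) → (x ⊕ y) ⊖ y ≡ x
  ⊕-⊖-cancel x y = toℕ-injective (begin
    toℕ ((x ⊕ y) ⊖ y)                        ≡⟨ toℕ-⊖ (x ⊕ y) y ⟩
    (toℕ (x ⊕ y) + (v ∸ toℕ y)) % v          ≡⟨ cong (λ a → (a + (v ∸ toℕ y)) % v) (toℕ-⊕ x y) ⟩
    ((toℕ x + toℕ y) % v + (v ∸ toℕ y)) % v  ≡⟨ [m%v+n]%v≡[m+n]%v (toℕ x + toℕ y) (v ∸ toℕ y) ⟩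
    (toℕ x + toℕ y + (v ∸ toℕ y)) % v        ≡⟨ cong (_% v) (+-assoc (toℕ x) (toℕ y) (v ∸ toℕ y)) ⟩
    (toℕ x + (toℕ y + (v ∸ toℕ y))) % v      ≡⟨ cong (λ a → (toℕ x + a) % v) (m+[n∸m]≡n (toℕ≤n y)) ⟩
    (toℕ x + v) % v                          ≡⟨ [x+v]%v≡x x ⟩
    toℕ x                                    ∎)

  ⊖≡⇒≡⊕ : {x y d : Fin v} → x ⊖ y ≡ d → x ≡ y ⊕ d
  ⊖≡⇒≡⊕ {x} {y} refl = trans (sym (⊖-⊕-cancel x y)) (⊕-comm (x ⊖ y) y)

  ≡⊕⇒⊖≡ : {x y d : Fin v} → x ≡ y ⊕ d → x ⊖ y ≡ d
  ≡⊕⇒⊖≡ {y = y} {d} refl = trans (cong (_⊖ y) (⊕-comm y d)) (⊕-⊖-cancel d y)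

  ⌊⊖≟⌋≡⌊≟⊕⌋ : (x y d : Fin v) → ⌊ x ⊖ y ≟ d ⌋ ≡ ⌊ x ≟ y ⊕ d ⌋
  ⌊⊖≟⌋≡⌊≟⊕⌋ x y d with x ⊖ y ≟ d | x ≟ y ⊕ d
  ... | yes _ | yes _ = refl
  ... | no  _ | no  _ = refl
  ... | yes p | no ¬q = ⊥-elim (¬q (⊖≡⇒≡⊕ p))
  ... | no ¬p | yes q = ⊥-elim (¬p (≡⊕⇒⊖≡ q))

  shift : Fin v → Permutation′ v
  shift s = permutation (_⊕ s) (_⊖ s) (λ x → ⊖-⊕-cancel x s) (λ x → ⊕-⊖-cancel x s)

sum-tabulate : ∀ {n} (f : Fin n → ℕ) → sumℕ (List.tabulate f) ≡ ∑[ i < n ] f i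
sum-tabulate {ℕ.zero}  f = refl
sum-tabulate {ℕ.suc n} f = cong (λ m → f zero + m) (sum-tabulate (f ∘ suc))

sum-map-allFin : ∀ {n} (f : Fin n → ℕ) → sumℕ (map f (allFin n)) ≡ ∑[ i < n ] f i
sum-map-allFin f = trans (cong sumℕ (map-tabulate (λ i → i) f)) (sum-tabulate f)

∑-one : ∀ n → ∑[ i < n ] 1 ≡ n
∑-one ℕ.zero    = refl
∑-one (ℕ.suc n) = cong ℕ.suc (∑-one n)

∑-select : ∀ {n} (a : Fin n) (g : Fin n → ℕ) → ∑[ x < n ] (if ⌊ x ≟ a ⌋ then g x else 0) ≡ g a
∑-select {ℕ.suc n} zero    g = trans (cong (λ m → g zero + m) (sum-replicate-zero n)) (+-identityʳ (g zero))
∑-select {ℕ.suc n} (suc a) g = trans (sum-cong-≗ summand) (∑-select a (g ∘ suc))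
  where
  summand : ∀ x → (if ⌊ suc x ≟ suc a ⌋ then g (suc x) else 0) ≡ (if ⌊ x ≟ a ⌋ then g (suc x) else 0)
  summand x with x ≟ a
  ... | yes _ = refl
  ... | no  _ = refl

∑-shift : ∀ {v} .{{_ : NonZero v}} (s : Fin v) (f : Fin v → ℕ) → ∑[ x < v ] f (x ⊕ s) ≡ ∑[ x < v ] f x
∑-shift s f = sym (∑-permute f (shift s))

indicator : ∀ {n} → Subset n → Fin n → ℕ
indicator X x = if lookup X x then 1 else 0

∣X∣≡∑indicator : ∀ {n} (X : Subset n) → ∣ X ∣ ≡ ∑[ x < n ] indicator X x
∣X∣≡∑indicator []          = refl
∣X∣≡∑indicator (true  ∷ X) = cong ℕ.suc (∣X∣≡∑indicator X)
∣X∣≡∑indicator (false ∷ X) = ∣X∣≡∑indicator X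

if-∧-∧ : ∀ a b c → (if a ∧ b ∧ c then 1 else 0) ≡ (if c then (if a then 1 else 0) * (if b then 1 else 0) else 0)
if-∧-∧ true  true  true  = refl
if-∧-∧ true  true  false = refl
if-∧-∧ true  false true  = refl
if-∧-∧ true  false false = refl
if-∧-∧ false b     true  = refl
if-∧-∧ false b     false = refl

diffCount≡∑indicator : ∀ {v} .{{_ : NonZero v}} (X : Subset v) (d : Fin v) →
                       diffCount X d ≡ ∑[ y < v ] (indicator X (y ⊕ d) * indicator X y)
diffCount≡∑indicator {v} X d = begin
  diffCount X d
    ≡⟨ sum-map-allFin (λ x → sumℕ (map (pair x) (allFin v))) ⟩
  ∑[ x < v ] sumℕ (map (pair x) (allFin v))
    ≡⟨ sum-cong-≗ (λ x → sum-map-allFin (pair x)) ⟩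
  ∑[ x < v ] ∑[ y < v ] pair x y
    ≡⟨ ∑-comm pair ⟩
  ∑[ y < v ] ∑[ x < v ] pair x y
    ≡⟨ sum-cong-≗ (λ y → sum-cong-≗ (λ x → pair≡ x y)) ⟩
  ∑[ y < v ] ∑[ x < v ] (if ⌊ x ≟ y ⊕ d ⌋ then indicator X x * indicator X y else 0)
    ≡⟨ sum-cong-≗ (λ y → ∑-select (y ⊕ d) (λ x → indicator X x * indicator X y)) ⟩
  ∑[ y < v ] (indicator X (y ⊕ d) * indicator X y)
    ∎
  where
  pair : Fin v → Fin v → ℕ
  pair x y = if lookup X x ∧ lookup X y ∧ ⌊ x ⊖ y ≟ d ⌋ then 1 else 0
  pair≡ : ∀ x y → pair x y ≡ (if ⌊ x ≟ y ⊕ d ⌋ then indicator X x * indicator X y else 0)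
  pair≡ x y = begin
    pair x y
      ≡⟨ cong (λ c → if lookup X x ∧ lookup X y ∧ c then 1 else 0) (⌊⊖≟⌋≡⌊≟⊕⌋ x y d) ⟩
    (if lookup X x ∧ lookup X y ∧ ⌊ x ≟ y ⊕ d ⌋ then 1 else 0)
      ≡⟨ if-∧-∧ (lookup X x) (lookup X y) ⌊ x ≟ y ⊕ d ⌋ ⟩
    (if ⌊ x ≟ y ⊕ d ⌋ then indicator X x * indicator X y else 0)
      ∎

sign : ∀ {n} → Subset n → Fin n → ℤ
sign X x = if lookup X x then - + 1 else + 1

sign-isPM1 : ∀ {n} (X : Subset n) → IsPM1 (sign X)
sign-isPM1 X x with lookup X x
... | true  = inj₂ refl
... | false = inj₁ refl

sign-* : ∀ {n} (X : Subset n) (x y : Fin n) →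
         sign X x *ℤ sign X y ≡
         + (1 + 4 * (indicator X y * indicator X x)) -ℤ + (2 * indicator X x + 2 * indicator X y)
sign-* X x y with lookup X x | lookup X y
... | true  | true  = refl
... | true  | false = refl
... | false | true  = refl
... | false | false = refl

[m-n]+[p-q]≡[m+p]-[n+q] : ∀ m n p q →
  (+ m -ℤ + n) +ℤ (+ p -ℤ + q) ≡ + (m + p) -ℤ + (n + q)
[m-n]+[p-q]≡[m+p]-[n+q] m n p q =
  trans (regroup (+ m) (+ n) (+ p) (+ q)) (sym (cong₂ _-ℤ_ (pos-+ m p) (pos-+ n q)))
  where
  regroup : ∀ a b c d → (a -ℤ b) +ℤ (c -ℤ d) ≡ (a +ℤ c) -ℤ (b +ℤ d)
  regroup = ℤ-Solver.solve-∀

m-[m+2]≡-2 : ∀ m → + m -ℤ + (m + 2) ≡ - + 2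
m-[m+2]≡-2 m = trans (cong (λ n → + m -ℤ n) (pos-+ m 2)) (cancel (+ m))
  where
  cancel : ∀ a → a -ℤ (a +ℤ + 2) ≡ - + 2
  cancel = ℤ-Solver.solve-∀

sumℤ-map-difference : ∀ {A : Set} (a b : A → ℕ) (xs : List A) →
  sumℤ (map (λ x → + a x -ℤ + b x) xs) ≡ + sumℕ (map a xs) -ℤ + sumℕ (map b xs)
sumℤ-map-difference a b List.[]       = refl
sumℤ-map-difference a b (x List.∷ xs) =
  trans (cong (λ z → + a x -ℤ + b x +ℤ z) (sumℤ-map-difference a b xs))
        ([m-n]+[p-q]≡[m+p]-[n+q] (a x) (b x) (sumℕ (map a xs)) (sumℕ (map b xs)))

autocorr-sign : ∀ {v} .{{_ : NonZero v}} (X : Subset v) (s : Fin v) →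
                autocorr (sign X) s ≡ + (v + 4 * diffCount X s) -ℤ + (4 * ∣ X ∣)
autocorr-sign {v} X s = begin
  autocorr (sign X) s
    ≡⟨ cong sumℤ (map-cong (λ x → sign-* X x (x ⊕ s)) (allFin v)) ⟩
  sumℤ (map (λ x → + agree x -ℤ + differ x) (allFin v))
    ≡⟨ sumℤ-map-difference agree differ (allFin v) ⟩
  + sumℕ (map agree (allFin v)) -ℤ + sumℕ (map differ (allFin v))
    ≡⟨ cong₂ (λ m n → + m -ℤ + n) ∑agree ∑differ ⟩
  + (v + 4 * diffCount X s) -ℤ + (4 * ∣ X ∣)
    ∎
  where
  agree differ : Fin v → ℕ
  agree  x = 1 + 4 * (indicator X (x ⊕ s) * indicator X x)
  differ x = 2 * indicator X x + 2 * indicator X (x ⊕ s)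

  ∑agree : sumℕ (map agree (allFin v)) ≡ v + 4 * diffCount X s
  ∑agree = begin
    sumℕ (map agree (allFin v))
      ≡⟨ sum-map-allFin agree ⟩
    ∑[ x < v ] agree x
      ≡⟨ ∑-distrib-+ (λ _ → 1) (λ x → 4 * (indicator X (x ⊕ s) * indicator X x)) ⟩
    ∑[ x < v ] 1 + ∑[ x < v ] (4 * (indicator X (x ⊕ s) * indicator X x))
      ≡⟨ cong₂ _+_ (∑-one v) (sym (*-distribˡ-sum 4 (λ x → indicator X (x ⊕ s) * indicator X x))) ⟩
    v + 4 * ∑[ x < v ] (indicator X (x ⊕ s) * indicator X x)
      ≡⟨ cong (λ m → v + 4 * m) (diffCount≡∑indicator X s) ⟨
    v + 4 * diffCount X s
      ∎

  ∑differ : sumℕ (map differ (allFin v)) ≡ 4 * ∣ X ∣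
  ∑differ = begin
    sumℕ (map differ (allFin v))
      ≡⟨ sum-map-allFin differ ⟩
    ∑[ x < v ] differ x
      ≡⟨ ∑-distrib-+ (λ x → 2 * indicator X x) (λ x → 2 * indicator X (x ⊕ s)) ⟩
    ∑[ x < v ] (2 * indicator X x) + ∑[ x < v ] (2 * indicator X (x ⊕ s))
      ≡⟨ cong₂ _+_ (*-distribˡ-sum 2 (indicator X)) (*-distribˡ-sum 2 (λ x → indicator X (x ⊕ s))) ⟨
    2 * ∑[ x < v ] indicator X x + 2 * ∑[ x < v ] indicator X (x ⊕ s)
      ≡⟨ cong (λ m → 2 * ∑[ x < v ] indicator X x + 2 * m) (∑-shift s (indicator X)) ⟩
    2 * ∑[ x < v ] indicator X x + 2 * ∑[ x < v ] indicator X x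
      ≡⟨ cong (λ m → 2 * m + 2 * m) (∣X∣≡∑indicator X) ⟨
    2 * ∣ X ∣ + 2 * ∣ X ∣
      ≡⟨ double (∣ X ∣) ⟩
    4 * ∣ X ∣
      ∎
    where
    double : ∀ k → 2 * k + 2 * k ≡ 4 * k
    double = ℕ-Solver.solve-∀

differenceFamily⇒legendrePair :
  ∀ {v} .{{_ : NonZero v}} {k₁ k₂ lam} {X Y : Subset v} →
  IsDifferenceFamily v k₁ k₂ lam X Y → v + 1 + 2 * lam ≡ 2 * (k₁ + k₂) →
  IsLegendrePair v (sign X) (sign Y)
differenceFamily⇒legendrePair {v} {k₁} {k₂} {lam} {X} {Y} (∣X∣≡k₁ , ∣Y∣≡k₂ , lam-fold) v+1+2lam≡2k =
  sign-isPM1 X , sign-isPM1 Y , autocorr-sum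
  where
  autocorr-sum : (s : Fin v) → toℕ s ≢ 0 → autocorr (sign X) s +ℤ autocorr (sign Y) s ≡ - + 2
  autocorr-sum s s≢0 = begin
    autocorr (sign X) s +ℤ autocorr (sign Y) s
      ≡⟨ cong₂ _+ℤ_ (autocorr-sign X s) (autocorr-sign Y s) ⟩
    (+ (v + 4 * Dx) -ℤ + (4 * ∣ X ∣)) +ℤ (+ (v + 4 * Dy) -ℤ + (4 * ∣ Y ∣))
      ≡⟨ [m-n]+[p-q]≡[m+p]-[n+q] (v + 4 * Dx) (4 * ∣ X ∣) (v + 4 * Dy) (4 * ∣ Y ∣) ⟩
    + (v + 4 * Dx + (v + 4 * Dy)) -ℤ + (4 * ∣ X ∣ + 4 * ∣ Y ∣)
      ≡⟨ cong (λ n → + (v + 4 * Dx + (v + 4 * Dy)) -ℤ + n) sizes ⟩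
    + (v + 4 * Dx + (v + 4 * Dy)) -ℤ + (v + 4 * Dx + (v + 4 * Dy) + 2)
      ≡⟨ m-[m+2]≡-2 (v + 4 * Dx + (v + 4 * Dy)) ⟩
    - + 2
      ∎
    where
    Dx Dy : ℕ
    Dx = diffCount X s
    Dy = diffCount Y s

    sizes : 4 * ∣ X ∣ + 4 * ∣ Y ∣ ≡ v + 4 * Dx + (v + 4 * Dy) + 2
    sizes = begin
      4 * ∣ X ∣ + 4 * ∣ Y ∣          ≡⟨ cong₂ (λ a b → 4 * a + 4 * b) ∣X∣≡k₁ ∣Y∣≡k₂ ⟩
      4 * k₁ + 4 * k₂                ≡⟨ factor k₁ k₂ ⟩
      2 * (2 * (k₁ + k₂))            ≡⟨ cong (2 *_) v+1+2lam≡2k ⟨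
      2 * (v + 1 + 2 * lam)          ≡⟨ cong (λ l → 2 * (v + 1 + 2 * l)) (lam-fold s s≢0) ⟨
      2 * (v + 1 + 2 * (Dx + Dy))    ≡⟨ expand v Dx Dy ⟩
      v + 4 * Dx + (v + 4 * Dy) + 2  ∎
      where
      factor : ∀ a b → 4 * a + 4 * b ≡ 2 * (2 * (a + b))
      factor = ℕ-Solver.solve-∀
      expand : ∀ w x y → 2 * (w + 1 + 2 * (x + y)) ≡ w + 4 * x + (w + 4 * y) + 2
      expand = ℕ-Solver.solve-∀

elements : ∀ {n} → Subset n → List (Fin n)
elements []          = List.[]
elements (true  ∷ X) = zero List.∷ map suc (elements X)
elements (false ∷ X) = map suc (elements X)

∑-restrict : ∀ {n} (X : Subset n) (g : Fin n → ℕ) →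
             ∑[ x < n ] (if lookup X x then g x else 0) ≡ sumℕ (map g (elements X))
∑-restrict []          g = refl
∑-restrict (true  ∷ X) g = cong (λ m → g zero + m) (trans (∑-restrict X (g ∘ suc)) (cong sumℕ (map-∘ (elements X))))
∑-restrict (false ∷ X) g = trans (∑-restrict X (g ∘ suc)) (cong sumℕ (map-∘ (elements X)))

-- Costs |X| lookups per shift, against the v² pairs enumerated by diffCount.
coincidences : ∀ {v} .{{_ : NonZero v}} → Subset v → Fin v → ℕ
coincidences X d = sumℕ (map (λ y → indicator X (y ⊕ d)) (elements X))

diffCount≡coincidences : ∀ {v} .{{_ : NonZero v}} (X : Subset v) (d : Fin v) → diffCount X d ≡ coincidences X d
diffCount≡coincidences X d =
  trans (diffCount≡∑indicator X d) (trans (sum-cong-≗ restricted) (∑-restrict X (λ y → indicator X (y ⊕ d))))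
  where
  restricted : ∀ y → indicator X (y ⊕ d) * indicator X y ≡ (if lookup X y then indicator X (y ⊕ d) else 0)
  restricted y with lookup X y
  ... | true  = *-identityʳ (indicator X (y ⊕ d))
  ... | false = *-zeroʳ (indicator X (y ⊕ d))

-- X₁₂₃ and Y₁₂₃ in normal form; a lookup in the unevaluated mulSet recomputes all the products h·s.
X₁₂₃-table : Subset 123
X₁₂₃-table =
  true ∷ true ∷ false ∷ true ∷ false ∷ false ∷ true ∷ true ∷ false ∷ false ∷ true ∷ true ∷
  false ∷ true ∷ false ∷ false ∷ true ∷ false ∷ false ∷ false ∷ false ∷ false ∷ false ∷ false ∷
  false ∷ false ∷ false ∷ false ∷ true ∷ true ∷ true ∷ false ∷ false ∷ true ∷ true ∷ true ∷
  true ∷ true ∷ true ∷ false ∷ false ∷ false ∷ false ∷ true ∷ true ∷ true ∷ false ∷ false ∷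
  true ∷ false ∷ false ∷ false ∷ true ∷ true ∷ true ∷ false ∷ true ∷ false ∷ false ∷ true ∷
  true ∷ true ∷ false ∷ false ∷ false ∷ true ∷ true ∷ false ∷ true ∷ false ∷ true ∷ true ∷
  true ∷ true ∷ false ∷ false ∷ false ∷ false ∷ false ∷ true ∷ false ∷ true ∷ false ∷ true ∷
  true ∷ true ∷ false ∷ false ∷ false ∷ true ∷ false ∷ false ∷ true ∷ false ∷ true ∷ true ∷
  true ∷ false ∷ true ∷ true ∷ true ∷ false ∷ true ∷ false ∷ true ∷ true ∷ false ∷ false ∷
  true ∷ false ∷ true ∷ true ∷ true ∷ false ∷ true ∷ true ∷ true ∷ false ∷ true ∷ true ∷
  false ∷ false ∷ false ∷ []

Y₁₂₃-table : Subset 123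
Y₁₂₃-table =
  false ∷ false ∷ false ∷ false ∷ true ∷ true ∷ true ∷ false ∷ true ∷ false ∷ false ∷ true ∷
  false ∷ false ∷ true ∷ true ∷ false ∷ true ∷ true ∷ true ∷ false ∷ false ∷ true ∷ false ∷
  true ∷ true ∷ true ∷ true ∷ true ∷ false ∷ false ∷ true ∷ false ∷ true ∷ true ∷ false ∷
  true ∷ false ∷ true ∷ false ∷ true ∷ true ∷ true ∷ false ∷ false ∷ true ∷ false ∷ true ∷
  false ∷ false ∷ true ∷ true ∷ true ∷ true ∷ false ∷ true ∷ false ∷ true ∷ true ∷ false ∷
  true ∷ false ∷ true ∷ true ∷ true ∷ false ∷ true ∷ true ∷ false ∷ false ∷ false ∷ false ∷
  true ∷ false ∷ false ∷ false ∷ true ∷ false ∷ true ∷ true ∷ true ∷ true ∷ false ∷ false ∷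
  true ∷ false ∷ false ∷ false ∷ true ∷ false ∷ false ∷ false ∷ false ∷ false ∷ true ∷ false ∷
  true ∷ true ∷ false ∷ true ∷ false ∷ true ∷ true ∷ false ∷ false ∷ true ∷ true ∷ false ∷
  true ∷ true ∷ true ∷ false ∷ false ∷ false ∷ true ∷ false ∷ true ∷ true ∷ false ∷ false ∷
  false ∷ false ∷ false ∷ []

X₁₂₃≡table : X₁₂₃ ≡ X₁₂₃-table
X₁₂₃≡table = refl

Y₁₂₃≡table : Y₁₂₃ ≡ Y₁₂₃-table
Y₁₂₃≡table = refl

coincidences₁₂₃ : (i : Fin 122) → coincidences X₁₂₃-table (suc i) + coincidences Y₁₂₃-table (suc i) ≡ 60
coincidences₁₂₃ = toWitness {a? = all? (λ i → coincidences X₁₂₃-table (suc i) + coincidences Y₁₂₃-table (suc i) ℕ.≟ 60)} tt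

isDifferenceFamily₁₂₃ : IsDifferenceFamily 123 61 61 60 X₁₂₃ Y₁₂₃
isDifferenceFamily₁₂₃ = subst₂ (IsDifferenceFamily 123 61 61 60) (sym X₁₂₃≡table) (sym Y₁₂₃≡table) (refl , refl , balanced)
  where
  balanced : (d : Fin 123) → toℕ d ≢ 0 → diffCount X₁₂₃-table d + diffCount Y₁₂₃-table d ≡ 60
  balanced zero    0≢0 = ⊥-elim (0≢0 refl)
  balanced (suc i) _   = begin
    diffCount X₁₂₃-table (suc i) + diffCount Y₁₂₃-table (suc i)
      ≡⟨ cong₂ _+_ (diffCount≡coincidences X₁₂₃-table (suc i)) (diffCount≡coincidences Y₁₂₃-table (suc i)) ⟩
    coincidences X₁₂₃-table (suc i) + coincidences Y₁₂₃-table (suc i)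
      ≡⟨ coincidences₁₂₃ i ⟩
    60
      ∎

mainTheorem4 : IsDifferenceFamily 123 61 61 60 X₁₂₃ Y₁₂₃ × LegendrePairExists 123
-- The implicit arguments are explicit so that Agda does not unify (and so evaluate) diffCount X₁₂₃.
mainTheorem4 =
  isDifferenceFamily₁₂₃ , sign X₁₂₃ , sign Y₁₂₃ ,
  differenceFamily⇒legendrePair {k₁ = 61} {61} {60} {X₁₂₃} {Y₁₂₃} isDifferenceFamily₁₂₃ refl
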